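{- Let $P=(X,\leq_P)$ be a finite poset with at least two points and no isolated points, and let $C=\{a,b,v,w\}\subseteq E(P)$ be a 4-crown in $P$, viewed as induced subposet of $P$. If the multigraph $\mathfrak{F}(P)$ is complete (any two vertices are joined both by an L-edge and by a U-edge), then $C$ is a retract of $P$ if and only if there exists a strict relation $x<_C y$ of $C$ such that no 4-crown bundle $F\in\mathcal{F}(P)$ contains both $x$ and $y$.
   Context: For $P=(X,\leq_P)$, $L(P)$, $U(P)$ are the minimal and maximal points, $E(P):=L(P)\cup U(P)$; ${\downarrow}_P y:=\{x: x\leq_P y\}$, ${\uparrow}_P y:=\{x:y\leq_P x\}$, $[x,y]_P:={\uparrow}_P x\cap{\downarrow}_P y$. A retract of $P$ is the image of an idempotent order-preserving map $r:P\to P$. A 4-crown in $P$ is a set $\{a,b,v,w\}$ with $a<_P v$, $a<_P w$, $b<_P v$, $b<_P w$, $a\parallel b$, $v\parallel w$; its inner is $[a,v]_P\cap[b,w]_P$, and it is improper if the inner is nonempty. 4-crown bundles: $\mathcal{C}_{imp}(P)$ is the set of improper 4-crowns contained in $E(P)$; $\mathcal{M}(P)$ is the union of the inners of all members of $\mathcal{C}_{imp}(P)$; for $m\in\mathcal{M}(P)$, $\Xi(m) := (L(P)\cap{\downarrow}_P m)\cup(U(P)\cap{\uparrow}_P m)$; $\mathcal{F}(P)$ is the set of inclusion-maximal members of $\{\Xi(m): m\in\mathcal{M}(P)\}$ (the 4-crown bundles). $\mathfrak{F}(P)$ is the multigraph with vertex set $\mathcal{F}(P)$ having an L-edge between $F,G$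 (loops allowed) iff $L(P)\cap F\cap G\neq\emptyset$ and a U-edge iff $U(P)\cap F\cap G\neq\emptyset$. -}

module Defs where

open import Level using (0ℓ)
open import Data.Nat using (ℕ)
open import Data.Fin using (Fin)
open import Data.Product using (Σ; ∃; _×_; _,_)
open import Data.Sum using (_⊎_)
open import Relation.Nullary using (¬_)
open import Relation.Binary using (Rel)
open import Relation.Binary.PropositionalEquality using (_≡_; _≢_)

module Poset {n : ℕ} (_≤_ : Rel (Fin n) 0ℓ) where

  X : Set
  X = Fin n

  _<_ : X → X → Set
  x < y = (x ≤ y) × (x ≢ y)

  _∥_ : X → X → Set
  x ∥ y = ¬ (x ≤ y) × ¬ (y ≤ x)

  L : X → Set
  L x = ∀ y → y ≤ x → y ≡ x

  U : X → Set
  U x = ∀ y → x ≤ y → y ≡ x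

  E : X → Set
  E x = L x ⊎ U x

  Isolated : X → Set
  Isolated x = ∀ y → (y ≤ x ⊎ x ≤ y) → y ≡ x

  NoIsolated : Set
  NoIsolated = ∀ x → ¬ Isolated x

  Crown : X → X → X → X → Set
  Crown a b v w =
    (a < v) × (a < w) × (b < v) × (b < w) × (a ∥ b) × (v ∥ w)

  Inner : X → X → X → X → X → Set
  Inner a b v w m = ((a ≤ m) × (m ≤ v)) × ((b ≤ m) × (m ≤ w))

  In4 : X → X → X → X → X → Set
  In4 a b v w y = (y ≡ a) ⊎ (y ≡ b) ⊎ (y ≡ v) ⊎ (y ≡ w)

  ImproperCrownInE : X → X → X → X → Set
  ImproperCrownInE a b v w =
    Crown a b v w × (E a × E b × E v × E w) × (∃ λ m → Inner a b v w m)

  M : X → Set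
  M m = Σ X λ a → Σ X λ b → Σ X λ v → Σ X λ w →
          ImproperCrownInE a b v w × Inner a b v w m

  Ξ : X → X → Set
  Ξ m x = (L x × (x ≤ m)) ⊎ (U x × (m ≤ x))

  _⊆_ : (X → Set) → (X → Set) → Set
  A ⊆ B = ∀ x → A x → B x

  -- m represents a 4-crown bundle: m ∈ M(P) and Ξ(m) is inclusion-maximal
  -- among {Ξ(m') : m' ∈ M(P)}.  The bundles F(P) are exactly the sets Ξ(m)
  -- for such m.
  BundleRep : X → Set
  BundleRep m = M m × (∀ m' → M m' → Ξ m ⊆ Ξ m' → Ξ m' ⊆ Ξ m)

  FComplete : Set
  FComplete = ∀ m m' → BundleRep m → BundleRep m' →
    (∃ λ x → L x × Ξ m x × Ξ m' x) × (∃ λ x → U x × Ξ m x × Ξ m' x)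

  Monotone : (X → X) → Set
  Monotone r = ∀ x y → x ≤ y → r x ≤ r y

  IsRetract : (X → Set) → Set
  IsRetract S = Σ (X → X) λ r →
    Monotone r × (∀ x → r (r x) ≡ r x) ×
    (∀ y → ((∃ λ x → r x ≡ y) → S y) × (S y → ∃ λ x → r x ≡ y))

{-# OPTIONS --safe #-}
-- Without isolated points L(P) and U(P) are disjoint, so a minimal (maximal) point of
-- a bundle Ξ(m) lies below (above) m.
--
-- (⇒) A retraction r onto C sends a bundle joining x ∈ {a, b} to y ∈ {v, w} to x or
-- to y. Two bundles of a complete 𝔉(P) share a minimal point l, so their images cannot
-- be a and b (both would equal r l); dually they cannot be v and w. Going through the
-- bundles joining (a, v), (b, w) and then (b, v) or (a, w), this rules out that all
-- four strict relations of C are joined by bundles.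
--
-- (⇐) Say a < v is separated. Send x to a if a is the only minimal point below x, else
-- to v if v is the only maximal point above x, else to w or b according as a ≤ x or
-- not. The only obstruction to monotonicity is a point x with a ≤ x ≤ v having another
-- minimal point l below and another maximal point u above; but then x lies in the
-- inner of the improper crown {a, l, v, u}, and a bundle containing Ξ(x) joins a and v.
module Submission where

open import Defs
open import Level using (0ℓ)
open import Data.Nat using (ℕ; _≤_)
open import Data.Fin using (Fin; _≟_)
open import Data.Fin.Properties using (any?; all?)
open import Data.Fin.Induction using (po-wellFounded; po-noetherian; spo-noetherian)
open import Data.Product using (∃; _×_; _,_; proj₁; proj₂)
open import Data.Sum using (_⊎_; inj₁; inj₂)
open import Data.Empty using (⊥; ⊥-elim)
open import Function using (_∘_; flip)
open import Function.Bundles using (_⇔_; mk⇔)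
open import Induction.WellFounded using (Acc; acc)
open import Relation.Nullary using (¬_; Dec; yes; no)
open import Relation.Nullary.Decidable using (_×-dec_; _⊎-dec_; _→-dec_; ¬?; decidable-stable)
open import Relation.Binary using (Rel; IsPartialOrder; IsStrictPartialOrder; Decidable)
open import Relation.Binary.PropositionalEquality
  using (_≡_; _≢_; refl; sym; subst; isEquivalence; resp₂; module ≡-Reasoning)
open import Relation.Unary using (_⊂′_)
open import Relation.Unary.Properties using (⊆′-refl; ⊆′-trans; ⊂′-irrefl; ⊂′-trans; ≐′-refl)

module _ {n : ℕ} (_≼_ : Rel (Fin n) 0ℓ) where
  open Poset _≼_

  Separated : X → X → Set
  Separated x y = ∀ m → BundleRep m → ¬ (Ξ m x × Ξ m y)

  Joined : X → X → Set
  Joined x y = ∃ λ m → BundleRep m × Ξ m x × Ξ m y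

  SeparatedPair : X → X → X → X → Set
  SeparatedPair a b v w = ∃ λ x → ∃ λ y →
    In4 a b v w x × In4 a b v w y × x < y × Separated x y

  OnlyMinimalBelow : X → X → Set
  OnlyMinimalBelow a x = a ≼ x × (∀ l → L l → l ≼ x → l ≡ a)

  OnlyMaximalAbove : X → X → Set
  OnlyMaximalAbove v x = x ≼ v × (∀ u → U u → x ≼ u → u ≡ v)

  minimal-not-above : ∀ {x y} → L y → ¬ (x < y)
  minimal-not-above Ly (x≼y , x≢y) = x≢y (Ly _ x≼y)

  maximal-not-below : ∀ {x y} → U x → ¬ (x < y)
  maximal-not-below Ux (x≼y , x≢y) = x≢y (sym (Ux _ x≼y))

  E-below⇒L : ∀ {x y} → E x → x < y → L x
  E-below⇒L (inj₁ Lx) _ = Lx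
  E-below⇒L (inj₂ Ux) x<y = ⊥-elim (maximal-not-below Ux x<y)

  E-above⇒U : ∀ {x y} → E y → x < y → U y
  E-above⇒U (inj₁ Ly) x<y = ⊥-elim (minimal-not-above Ly x<y)
  E-above⇒U (inj₂ Uy) _ = Uy

  distinct-minimal⇒∥ : ∀ {x y} → L x → L y → x ≢ y → x ∥ y
  distinct-minimal⇒∥ Lx Ly x≢y = (λ x≼y → x≢y (Ly _ x≼y)) , (λ y≼x → x≢y (sym (Lx _ y≼x)))

  distinct-maximal⇒∥ : ∀ {x y} → U x → U y → x ≢ y → x ∥ y
  distinct-maximal⇒∥ Ux Uy x≢y = (λ x≼y → x≢y (sym (Ux _ x≼y))) , (λ y≼x → x≢y (Uy _ y≼x))

  extremal-squeezed : ∀ {x c y} → L c ⊎ U c → x ≼ c → c ≼ y → c ≡ x ⊎ c ≡ y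
  extremal-squeezed (inj₁ Lc) x≼c _ = inj₁ (sym (Lc _ x≼c))
  extremal-squeezed (inj₂ Uc) _ c≼y = inj₂ (sym (Uc _ c≼y))

  Crown-swapˡ : ∀ {a b v w} → Crown a b v w → Crown b a v w
  Crown-swapˡ (a<v , a<w , b<v , b<w , (a⋠b , b⋠a) , v∥w) = b<v , b<w , a<v , a<w , (b⋠a , a⋠b) , v∥w

  Crown-swapʳ : ∀ {a b v w} → Crown a b v w → Crown a b w v
  Crown-swapʳ (a<v , a<w , b<v , b<w , a∥b , (v⋠w , w⋠v)) = a<w , a<v , b<w , b<v , a∥b , (w⋠v , v⋠w)

  In4-swapˡ : ∀ {a b v w y} → In4 a b v w y → In4 b a v w y
  In4-swapˡ (inj₁ y≡a) = inj₂ (inj₁ y≡a)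
  In4-swapˡ (inj₂ (inj₁ y≡b)) = inj₁ y≡b
  In4-swapˡ (inj₂ (inj₂ y∈vw)) = inj₂ (inj₂ y∈vw)

  In4-swapʳ : ∀ {a b v w y} → In4 a b v w y → In4 a b w v y
  In4-swapʳ (inj₁ y≡a) = inj₁ y≡a
  In4-swapʳ (inj₂ (inj₁ y≡b)) = inj₂ (inj₁ y≡b)
  In4-swapʳ (inj₂ (inj₂ (inj₁ y≡v))) = inj₂ (inj₂ (inj₂ y≡v))
  In4-swapʳ (inj₂ (inj₂ (inj₂ y≡w))) = inj₂ (inj₂ (inj₁ y≡w))

  IsRetract-resp : ∀ {S S' : X → Set} →
    (∀ {y} → S y → S' y) → (∀ {y} → S' y → S y) → IsRetract S → IsRetract S'
  IsRetract-resp S⇒S' S'⇒S (r , mono , idem , image) =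
    r , mono , idem , λ y → S⇒S' ∘ proj₁ (image y) , proj₂ (image y) ∘ S'⇒S

  retraction-onto : ∀ {S : X → Set} {r : X → X} →
    Monotone r → (∀ x → S (r x)) → (∀ {y} → S y → r y ≡ y) → IsRetract S
  retraction-onto {r = r} mono lands fixes =
    r , mono , (λ x → fixes (lands x)) , λ y → (λ { (x , refl) → lands x }) , (λ Sy → y , fixes Sy)

  retract-lands : ∀ {S : X → Set} (R : IsRetract S) x → S (proj₁ R x)
  retract-lands (r , _ , _ , image) x = proj₁ (image (r x)) (x , refl)

  retract-fixes : ∀ {S : X → Set} (R : IsRetract S) {y} → S y → proj₁ R y ≡ y
  retract-fixes (_ , _ , idem , image) Sy with proj₂ (image _) Sy
  ... | x , refl = idem x

  module Decidability (_≼?_ : Decidable _≼_) where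

    _<?_ : Decidable _<_
    x <? y = (x ≼? y) ×-dec ¬? (x ≟ y)

    _∥?_ : Decidable _∥_
    x ∥? y = ¬? (x ≼? y) ×-dec ¬? (y ≼? x)

    L? : ∀ x → Dec (L x)
    L? x = all? λ y → (y ≼? x) →-dec (y ≟ x)

    U? : ∀ x → Dec (U x)
    U? x = all? λ y → (x ≼? y) →-dec (y ≟ x)

    E? : ∀ x → Dec (E x)
    E? x = L? x ⊎-dec U? x

    Ξ? : ∀ m x → Dec (Ξ m x)
    Ξ? m x = (L? x ×-dec (x ≼? m)) ⊎-dec (U? x ×-dec (m ≼? x))

    _⊆Ξ?_ : ∀ m m' → Dec (Ξ m ⊆ Ξ m')
    m ⊆Ξ? m' = all? λ x → Ξ? m x →-dec Ξ? m' x

    Crown? : ∀ a b v w → Dec (Crown a b v w)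
    Crown? a b v w =
      (a <? v) ×-dec (a <? w) ×-dec (b <? v) ×-dec (b <? w) ×-dec (a ∥? b) ×-dec (v ∥? w)

    Inner? : ∀ a b v w m → Dec (Inner a b v w m)
    Inner? a b v w m = ((a ≼? m) ×-dec (m ≼? v)) ×-dec ((b ≼? m) ×-dec (m ≼? w))

    ImproperCrownInE? : ∀ a b v w → Dec (ImproperCrownInE a b v w)
    ImproperCrownInE? a b v w =
      Crown? a b v w ×-dec (E? a ×-dec E? b ×-dec E? v ×-dec E? w) ×-dec any? (Inner? a b v w)

    M? : ∀ m → Dec (M m)
    M? m = any? λ a → any? λ b → any? λ v → any? λ w →
      ImproperCrownInE? a b v w ×-dec Inner? a b v w m

    BundleRep? : ∀ m → Dec (BundleRep m)
    BundleRep? m = M? m ×-dec all? λ m' → M? m' →-dec m ⊆Ξ? m' →-dec m' ⊆Ξ? m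

    OnlyMinimalBelow? : ∀ a x → Dec (OnlyMinimalBelow a x)
    OnlyMinimalBelow? a x = (a ≼? x) ×-dec all? λ l → L? l →-dec (l ≼? x) →-dec (l ≟ a)

    OnlyMaximalAbove? : ∀ v x → Dec (OnlyMaximalAbove v x)
    OnlyMaximalAbove? v x = (x ≼? v) ×-dec all? λ u → U? u →-dec (x ≼? u) →-dec (u ≟ v)

    joined-or-separated : ∀ x y → Joined x y ⊎ Separated x y
    joined-or-separated x y with any? (λ m → BundleRep? m ×-dec Ξ? m x ×-dec Ξ? m y)
    ... | yes joined = inj₁ joined
    ... | no ¬joined = inj₂ λ m rep ξs → ¬joined (m , rep , ξs)

    other-minimal-below : ∀ {a x} → a ≼ x → ¬ OnlyMinimalBelow a x →
      ∃ λ l → L l × l ≼ x × l ≢ a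
    other-minimal-below {a} {x} a≼x ¬only with any? (λ l → L? l ×-dec (l ≼? x) ×-dec ¬? (l ≟ a))
    ... | yes other = other
    ... | no none = ⊥-elim (¬only (a≼x , λ l Ll l≼x →
      decidable-stable (l ≟ a) λ l≢a → none (l , Ll , l≼x , l≢a)))

    other-maximal-above : ∀ {v x} → x ≼ v → ¬ OnlyMaximalAbove v x →
      ∃ λ u → U u × x ≼ u × u ≢ v
    other-maximal-above {v} {x} x≼v ¬only with any? (λ u → U? u ×-dec (x ≼? u) ×-dec ¬? (u ≟ v))
    ... | yes other = other
    ... | no none = ⊥-elim (¬only (x≼v , λ u Uu x≼u →
      decidable-stable (u ≟ v) λ u≢v → none (u , Uu , x≼u , u≢v)))

  module FinitePoset (po : IsPartialOrder _≡_ _≼_) (_≼?_ : Decidable _≼_) where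
    open IsPartialOrder po using () renaming (refl to ≼-refl; trans to ≼-trans)
    open Decidability _≼?_

    minimal-below : ∀ x → ∃ λ l → L l × l ≼ x
    minimal-below x = descend (po-wellFounded po x)
      where
      descend : ∀ {x} → Acc _<_ x → ∃ λ l → L l × l ≼ x
      descend {x} (acc smaller) with any? (_<? x)
      ... | yes (y , y<x) = let l , Ll , l≼y = descend (smaller y<x) in l , Ll , ≼-trans l≼y (proj₁ y<x)
      ... | no nothing-below =
        x , (λ y y≼x → decidable-stable (y ≟ x) λ y≢x → nothing-below (y , y≼x , y≢x)) , ≼-refl

    maximal-above : ∀ x → ∃ λ u → U u × x ≼ u
    maximal-above x = ascend (po-noetherian po x)
      where
      ascend : ∀ {x} → Acc (flip _<_) x → ∃ λ u → U u × x ≼ u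
      ascend {x} (acc larger) with any? (x <?_)
      ... | yes (y , x<y) = let u , Uu , y≼u = ascend (larger x<y) in u , Uu , ≼-trans (proj₁ x<y) y≼u
      ... | no nothing-above =
        x , (λ y x≼y → decidable-stable (y ≟ x) λ y≢x → nothing-above (y , x≼y , y≢x ∘ sym)) , ≼-refl

    _⊏_ : Rel X 0ℓ
    m ⊏ m' = Ξ m ⊂′ Ξ m'

    ⊏-isStrictPartialOrder : IsStrictPartialOrder _≡_ _⊏_
    ⊏-isStrictPartialOrder = record
      { isEquivalence = isEquivalence
      ; irrefl = λ { refl → ⊂′-irrefl ≐′-refl }
      ; trans = ⊂′-trans
      ; <-resp-≈ = resp₂ _⊏_
      }

    bundleRep-above : ∀ m → M m → ∃ λ m' → BundleRep m' × Ξ m ⊆ Ξ m'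
    bundleRep-above m = ascend (spo-noetherian ⊏-isStrictPartialOrder m)
      where
      ascend : ∀ {m} → Acc (flip _⊏_) m → M m → ∃ λ m' → BundleRep m' × Ξ m ⊆ Ξ m'
      ascend {m} (acc larger) Mm with any? (λ m' → M? m' ×-dec m ⊆Ξ? m' ×-dec ¬? (m' ⊆Ξ? m))
      ... | yes (m' , Mm' , m⊏m') =
        let m'' , rep , m'⊆m'' = ascend (larger m⊏m') Mm' in m'' , rep , ⊆′-trans (proj₁ m⊏m') m'⊆m''
      ... | no nothing-larger =
        m , (Mm , λ m' Mm' m⊆m' → decidable-stable (m' ⊆Ξ? m) λ m'⊈m →
                   nothing-larger (m' , Mm' , m⊆m' , m'⊈m))
          , ⊆′-refl

    OnlyMinimalBelow-downward : ∀ {a x y} → x ≼ y → OnlyMinimalBelow a y → OnlyMinimalBelow a x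
    OnlyMinimalBelow-downward {x = x} x≼y (_ , only) =
      let l , Ll , l≼x = minimal-below x in
      subst (_≼ x) (only l Ll (≼-trans l≼x x≼y)) l≼x , λ l' Ll' l'≼x → only l' Ll' (≼-trans l'≼x x≼y)

    OnlyMaximalAbove-upward : ∀ {v x y} → x ≼ y → OnlyMaximalAbove v x → OnlyMaximalAbove v y
    OnlyMaximalAbove-upward {y = y} x≼y (_ , only) =
      let u , Uu , y≼u = maximal-above y in
      subst (y ≼_) (only u Uu (≼-trans x≼y y≼u)) y≼u , λ u' Uu' y≼u' → only u' Uu' (≼-trans x≼y y≼u')

  module WithoutIsolatedPoints (po : IsPartialOrder _≡_ _≼_) (_≼?_ : Decidable _≼_)
                               (noIsolated : NoIsolated) where
    open IsPartialOrder po using () renaming (refl to ≼-refl; trans to ≼-trans)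
    open Decidability _≼?_
    open FinitePoset po _≼?_
    open ≡-Reasoning

    ∥⇒≢ : ∀ {x y} → x ∥ y → x ≢ y
    ∥⇒≢ (x⋠y , _) refl = x⋠y ≼-refl

    minimal-not-maximal : ∀ {x} → L x → ¬ U x
    minimal-not-maximal {x} Lx Ux = noIsolated x λ { y (inj₁ y≼x) → Lx y y≼x ; y (inj₂ x≼y) → Ux y x≼y }

    minimal-below-maximal : ∀ {x y} → L x → U y → x ≼ y → x < y
    minimal-below-maximal Lx Uy x≼y = x≼y , λ { refl → minimal-not-maximal Lx Uy }

    Ξ-minimal⇒≼ : ∀ {m x} → L x → Ξ m x → x ≼ m
    Ξ-minimal⇒≼ _ (inj₁ (_ , x≼m)) = x≼m
    Ξ-minimal⇒≼ Lx (inj₂ (Ux , _)) = ⊥-elim (minimal-not-maximal Lx Ux)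

    Ξ-maximal⇒≽ : ∀ {m x} → U x → Ξ m x → m ≼ x
    Ξ-maximal⇒≽ Ux (inj₁ (Lx , _)) = ⊥-elim (minimal-not-maximal Lx Ux)
    Ξ-maximal⇒≽ _ (inj₂ (_ , m≼x)) = m≼x

    M-intro : ∀ {a b v w x} → L a → L b → U v → U w → a ≢ b → v ≢ w → Inner a b v w x → M x
    M-intro {a} {b} {v} {w} {x} La Lb Uv Uw a≢b v≢w inner@((a≼x , x≼v) , (b≼x , x≼w)) =
      a , b , v , w , (crown , (inj₁ La , inj₁ Lb , inj₂ Uv , inj₂ Uw) , (x , inner)) , inner
      where
      crown : Crown a b v w
      crown = minimal-below-maximal La Uv (≼-trans a≼x x≼v)
            , minimal-below-maximal La Uw (≼-trans a≼x x≼w)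
            , minimal-below-maximal Lb Uv (≼-trans b≼x x≼v)
            , minimal-below-maximal Lb Uw (≼-trans b≼x x≼w)
            , distinct-minimal⇒∥ La Lb a≢b , distinct-maximal⇒∥ Uv Uw v≢w

    between-separated : ∀ {a v x} → Separated a v → L a → U v → a ≼ x → x ≼ v →
      ¬ OnlyMinimalBelow a x → ¬ OnlyMaximalAbove v x → ⊥
    between-separated {a} {v} {x} sep La Uv a≼x x≼v ¬onlyA ¬onlyV =
      let l , Ll , l≼x , l≢a = other-minimal-below a≼x ¬onlyA
          u , Uu , x≼u , u≢v = other-maximal-above x≼v ¬onlyV
          Mx = M-intro La Ll Uv Uu (l≢a ∘ sym) (u≢v ∘ sym) ((a≼x , x≼v) , (l≼x , x≼u))
          m , rep , Ξx⊆Ξm = bundleRep-above x Mx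
      in sep m rep (Ξx⊆Ξm a (inj₁ (La , a≼x)) , Ξx⊆Ξm v (inj₂ (Uv , x≼v)))

    minimal-images-agree : FComplete → ∀ {r m m'} → Monotone r → BundleRep m → BundleRep m' →
      L (r m) → L (r m') → r m ≡ r m'
    minimal-images-agree complete {r} {m} {m'} mono rep rep' L-rm L-rm'
      with proj₁ (complete _ _ rep rep')
    ... | l , Ll , l∈Ξm , l∈Ξm' = begin
      r m  ≡⟨ sym (L-rm (r l) (mono _ _ (Ξ-minimal⇒≼ Ll l∈Ξm))) ⟩
      r l  ≡⟨ L-rm' (r l) (mono _ _ (Ξ-minimal⇒≼ Ll l∈Ξm')) ⟩
      r m' ∎

    maximal-images-agree : FComplete → ∀ {r m m'} → Monotone r → BundleRep m → BundleRep m' →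
      U (r m) → U (r m') → r m ≡ r m'
    maximal-images-agree complete {r} {m} {m'} mono rep rep' U-rm U-rm'
      with proj₂ (complete _ _ rep rep')
    ... | u , Uu , u∈Ξm , u∈Ξm' = begin
      r m  ≡⟨ sym (U-rm (r u) (mono _ _ (Ξ-maximal⇒≽ Uu u∈Ξm))) ⟩
      r u  ≡⟨ U-rm' (r u) (mono _ _ (Ξ-maximal⇒≽ Uu u∈Ξm')) ⟩
      r m' ∎

    module CrownRetraction {a b v w} (La : L a) (Lb : L b) (Uv : U v) (Uw : U w)
        (a≼v : a ≼ v) (a≼w : a ≼ w) (b≼v : b ≼ v) (b≼w : b ≼ w) (a∥b : a ∥ b) (v∥w : v ∥ w)
        (a⋈v : Separated a v) where

      data Region (x : X) : Set where
        to-a : OnlyMinimalBelow a x → Region x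
        to-v : ¬ OnlyMinimalBelow a x → OnlyMaximalAbove v x → Region x
        to-w : ¬ OnlyMinimalBelow a x → ¬ OnlyMaximalAbove v x → a ≼ x → Region x
        to-b : ¬ OnlyMinimalBelow a x → ¬ OnlyMaximalAbove v x → ¬ a ≼ x → Region x

      region : ∀ x → Region x
      region x with OnlyMinimalBelow? a x | OnlyMaximalAbove? v x | a ≼? x
      ... | yes onlyA | _ | _ = to-a onlyA
      ... | no ¬onlyA | yes onlyV | _ = to-v ¬onlyA onlyV
      ... | no ¬onlyA | no ¬onlyV | yes a≼x = to-w ¬onlyA ¬onlyV a≼x
      ... | no ¬onlyA | no ¬onlyV | no a⋠x = to-b ¬onlyA ¬onlyV a⋠x

      target : ∀ {x} → Region x → X
      target (to-a _) = a
      target (to-v _ _) = v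
      target (to-w _ _ _) = w
      target (to-b _ _ _) = b

      r : X → X
      r x = target (region x)

      target-mono : ∀ {x y} → x ≼ y → (ρ : Region x) (σ : Region y) → target ρ ≼ target σ
      target-mono _ (to-a _) (to-a _) = ≼-refl
      target-mono _ (to-a _) (to-v _ _) = a≼v
      target-mono _ (to-a _) (to-w _ _ _) = a≼w
      target-mono x≼y (to-a (a≼x , _)) (to-b _ _ a⋠y) = ⊥-elim (a⋠y (≼-trans a≼x x≼y))
      target-mono x≼y (to-v ¬onlyA _) (to-a onlyA) = ⊥-elim
        (¬onlyA (OnlyMinimalBelow-downward x≼y onlyA))
      target-mono _ (to-v _ _) (to-v _ _) = ≼-refl
      target-mono x≼y (to-v _ onlyV) (to-w _ ¬onlyV _) = ⊥-elim
        (¬onlyV (OnlyMaximalAbove-upward x≼y onlyV))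
      target-mono x≼y (to-v _ onlyV) (to-b _ ¬onlyV _) = ⊥-elim
        (¬onlyV (OnlyMaximalAbove-upward x≼y onlyV))
      target-mono x≼y (to-w ¬onlyA _ _) (to-a onlyA) = ⊥-elim
        (¬onlyA (OnlyMinimalBelow-downward x≼y onlyA))
      target-mono x≼y (to-w ¬onlyA ¬onlyV a≼x) (to-v _ (y≼v , _)) =
        ⊥-elim (between-separated a⋈v La Uv a≼x (≼-trans x≼y y≼v) ¬onlyA ¬onlyV)
      target-mono _ (to-w _ _ _) (to-w _ _ _) = ≼-refl
      target-mono x≼y (to-w _ _ a≼x) (to-b _ _ a⋠y) = ⊥-elim (a⋠y (≼-trans a≼x x≼y))
      target-mono x≼y (to-b ¬onlyA _ _) (to-a onlyA) = ⊥-elim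
        (¬onlyA (OnlyMinimalBelow-downward x≼y onlyA))
      target-mono _ (to-b _ _ _) (to-v _ _) = b≼v
      target-mono _ (to-b _ _ _) (to-w _ _ _) = b≼w
      target-mono _ (to-b _ _ _) (to-b _ _ _) = ≼-refl

      target-In4 : ∀ {x} (ρ : Region x) → In4 a b v w (target ρ)
      target-In4 (to-a _) = inj₁ refl
      target-In4 (to-b _ _ _) = inj₂ (inj₁ refl)
      target-In4 (to-v _ _) = inj₂ (inj₂ (inj₁ refl))
      target-In4 (to-w _ _ _) = inj₂ (inj₂ (inj₂ refl))

      onlyA-a : OnlyMinimalBelow a a
      onlyA-a = ≼-refl , λ l Ll l≼a → La l l≼a

      onlyV-v : OnlyMaximalAbove v v
      onlyV-v = ≼-refl , λ u Uu v≼u → Uv u v≼u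

      ¬onlyA-above-b : ∀ {x} → b ≼ x → ¬ OnlyMinimalBelow a x
      ¬onlyA-above-b b≼x (_ , only) = proj₁ a∥b (subst (_≼ b) (only b Lb b≼x) ≼-refl)

      ¬onlyV-below-w : ∀ {x} → x ≼ w → ¬ OnlyMaximalAbove v x
      ¬onlyV-below-w x≼w (_ , only) = proj₁ v∥w (subst (v ≼_) (sym (only w Uw x≼w)) ≼-refl)

      target-a : (ρ : Region a) → target ρ ≡ a
      target-a (to-a _) = refl
      target-a (to-v ¬onlyA _) = ⊥-elim (¬onlyA onlyA-a)
      target-a (to-w ¬onlyA _ _) = ⊥-elim (¬onlyA onlyA-a)
      target-a (to-b ¬onlyA _ _) = ⊥-elim (¬onlyA onlyA-a)

      target-b : (ρ : Region b) → target ρ ≡ b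
      target-b (to-a onlyA) = ⊥-elim (¬onlyA-above-b ≼-refl onlyA)
      target-b (to-v _ onlyV) = ⊥-elim (¬onlyV-below-w b≼w onlyV)
      target-b (to-w _ _ a≼b) = ⊥-elim (proj₁ a∥b a≼b)
      target-b (to-b _ _ _) = refl

      target-v : (ρ : Region v) → target ρ ≡ v
      target-v (to-a onlyA) = ⊥-elim (¬onlyA-above-b b≼v onlyA)
      target-v (to-v _ _) = refl
      target-v (to-w _ ¬onlyV _) = ⊥-elim (¬onlyV onlyV-v)
      target-v (to-b _ ¬onlyV _) = ⊥-elim (¬onlyV onlyV-v)

      target-w : (ρ : Region w) → target ρ ≡ w
      target-w (to-a onlyA) = ⊥-elim (¬onlyA-above-b b≼w onlyA)
      target-w (to-v _ onlyV) = ⊥-elim (¬onlyV-below-w ≼-refl onlyV)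
      target-w (to-w _ _ _) = refl
      target-w (to-b _ _ a⋠w) = ⊥-elim (a⋠w a≼w)

      r-fixes : ∀ {y} → In4 a b v w y → r y ≡ y
      r-fixes (inj₁ refl) = target-a (region a)
      r-fixes (inj₂ (inj₁ refl)) = target-b (region b)
      r-fixes (inj₂ (inj₂ (inj₁ refl))) = target-v (region v)
      r-fixes (inj₂ (inj₂ (inj₂ refl))) = target-w (region w)

      retract : IsRetract (In4 a b v w)
      retract = retraction-onto (λ x y x≼y → target-mono x≼y (region x) (region y))
                                (target-In4 ∘ region) r-fixes

    crown-retract : ∀ {a b v w} → Crown a b v w → L a → L b → U v → U w → Separated a v →
      IsRetract (In4 a b v w)
    crown-retract ((a≼v , _) , (a≼w , _) , (b≼v , _) , (b≼w , _) , a∥b , v∥w) La Lb Uv Uw a⋈v =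
      CrownRetraction.retract La Lb Uv Uw a≼v a≼w b≼v b≼w a∥b v∥w a⋈v

    separated⇒retract : ∀ {a b v w} → Crown a b v w → L a → L b → U v → U w →
      SeparatedPair a b v w → IsRetract (In4 a b v w)
    separated⇒retract C La Lb Uv Uw (_ , _ , inj₁ refl , inj₂ (inj₂ (inj₁ refl)) , _ , sep) =
      crown-retract C La Lb Uv Uw sep
    separated⇒retract C La Lb Uv Uw (_ , _ , inj₁ refl , inj₂ (inj₂ (inj₂ refl)) , _ , sep) =
      IsRetract-resp In4-swapʳ In4-swapʳ (crown-retract (Crown-swapʳ C) La Lb Uw Uv sep)
    separated⇒retract C La Lb Uv Uw (_ , _ , inj₂ (inj₁ refl) , inj₂ (inj₂ (inj₁ refl)) , _ , sep) =
      IsRetract-resp In4-swapˡ In4-swapˡ (crown-retract (Crown-swapˡ C) Lb La Uv Uw sep)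
    separated⇒retract C La Lb Uv Uw (_ , _ , inj₂ (inj₁ refl) , inj₂ (inj₂ (inj₂ refl)) , _ , sep) =
      IsRetract-resp (In4-swapˡ ∘ In4-swapʳ) (In4-swapʳ ∘ In4-swapˡ)
        (crown-retract (Crown-swapˡ (Crown-swapʳ C)) Lb La Uw Uv sep)
    separated⇒retract _ La _ _ _ (_ , _ , _ , inj₁ refl , x<a , _) =
      ⊥-elim (minimal-not-above La x<a)
    separated⇒retract _ _ Lb _ _ (_ , _ , _ , inj₂ (inj₁ refl) , x<b , _) =
      ⊥-elim (minimal-not-above Lb x<b)
    separated⇒retract _ _ _ Uv _ (_ , _ , inj₂ (inj₂ (inj₁ refl)) , _ , v<y , _) =
      ⊥-elim (maximal-not-below Uv v<y)
    separated⇒retract _ _ _ _ Uw (_ , _ , inj₂ (inj₂ (inj₂ refl)) , _ , w<y , _) =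
      ⊥-elim (maximal-not-below Uw w<y)

    module RetractionObstruction (complete : FComplete) {a b v w} (a∥b : a ∥ b) (v∥w : v ∥ w)
        (La : L a) (Lb : L b) (Uv : U v) (Uw : U w) {r : X → X} (mono : Monotone r)
        (r-fixes : ∀ {c} → In4 a b v w c → r c ≡ c) (r-lands : ∀ x → In4 a b v w (r x)) where

      In4-extremal : ∀ {c} → In4 a b v w c → L c ⊎ U c
      In4-extremal (inj₁ refl) = inj₁ La
      In4-extremal (inj₂ (inj₁ refl)) = inj₁ Lb
      In4-extremal (inj₂ (inj₂ (inj₁ refl))) = inj₂ Uv
      In4-extremal (inj₂ (inj₂ (inj₂ refl))) = inj₂ Uw

      joining-bundle-image : ∀ {x y} → In4 a b v w x → In4 a b v w y → L x → U y → Joined x y →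
        ∃ λ m → BundleRep m × (r m ≡ x ⊎ r m ≡ y)
      joining-bundle-image x∈C y∈C Lx Uy (m , rep , x∈Ξm , y∈Ξm) =
        m , rep , extremal-squeezed (In4-extremal (r-lands m))
          (subst (_≼ r m) (r-fixes x∈C) (mono _ _ (Ξ-minimal⇒≼ Lx x∈Ξm)))
          (subst (r m ≼_) (r-fixes y∈C) (mono _ _ (Ξ-maximal⇒≽ Uy y∈Ξm)))

      images-not-a-b : ∀ {m m'} → BundleRep m → BundleRep m' → r m ≡ a → r m' ≡ b → ⊥
      images-not-a-b {m} {m'} rep rep' rm≡a rm'≡b = ∥⇒≢ a∥b (begin
        a    ≡⟨ sym rm≡a ⟩
        r m  ≡⟨ minimal-images-agree complete mono rep rep'
                  (subst L (sym rm≡a) La) (subst L (sym rm'≡b) Lb) ⟩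
        r m' ≡⟨ rm'≡b ⟩
        b    ∎)

      images-not-v-w : ∀ {m m'} → BundleRep m → BundleRep m' → r m ≡ v → r m' ≡ w → ⊥
      images-not-v-w {m} {m'} rep rep' rm≡v rm'≡w = ∥⇒≢ v∥w (begin
        v    ≡⟨ sym rm≡v ⟩
        r m  ≡⟨ maximal-images-agree complete mono rep rep'
                  (subst U (sym rm≡v) Uv) (subst U (sym rm'≡w) Uw) ⟩
        r m' ≡⟨ rm'≡w ⟩
        w    ∎)

      a∈C : In4 a b v w a
      a∈C = inj₁ refl

      b∈C : In4 a b v w b
      b∈C = inj₂ (inj₁ refl)

      v∈C : In4 a b v w v
      v∈C = inj₂ (inj₂ (inj₁ refl))

      w∈C : In4 a b v w w
      w∈C = inj₂ (inj₂ (inj₂ refl))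

      not-all-joined : Joined a v → Joined a w → Joined b v → Joined b w → ⊥
      not-all-joined av aw bv bw
        with joining-bundle-image a∈C v∈C La Uv av | joining-bundle-image b∈C w∈C Lb Uw bw
      ... | _ , rep₁ , inj₁ r≡a | _ , rep₂ , inj₁ r≡b = images-not-a-b rep₁ rep₂ r≡a r≡b
      ... | _ , rep₁ , inj₂ r≡v | _ , rep₂ , inj₂ r≡w = images-not-v-w rep₁ rep₂ r≡v r≡w
      ... | _ , rep₁ , inj₁ r≡a | _ , rep₂ , inj₂ r≡w with joining-bundle-image b∈C v∈C Lb Uv bv
      ...   | _ , rep₃ , inj₁ r≡b = images-not-a-b rep₁ rep₃ r≡a r≡b
      ...   | _ , rep₃ , inj₂ r≡v = images-not-v-w rep₃ rep₂ r≡v r≡w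
      not-all-joined av aw bv bw
        | _ , rep₁ , inj₂ r≡v | _ , rep₂ , inj₁ r≡b with joining-bundle-image a∈C w∈C La Uw aw
      ...   | _ , rep₃ , inj₁ r≡a = images-not-a-b rep₃ rep₂ r≡a r≡b
      ...   | _ , rep₃ , inj₂ r≡w = images-not-v-w rep₁ rep₃ r≡v r≡w

    retract⇒separated : FComplete → ∀ {a b v w} → Crown a b v w → L a → L b → U v → U w →
      IsRetract (In4 a b v w) → SeparatedPair a b v w
    retract⇒separated complete {a} {b} {v} {w} (a<v , a<w , b<v , b<w , a∥b , v∥w) La Lb Uv Uw R
      with joined-or-separated a v | joined-or-separated a w
         | joined-or-separated b v | joined-or-separated b w
    ... | inj₂ a⋈v | _ | _ | _ = a , v , inj₁ refl , inj₂ (inj₂ (inj₁ refl)) , a<v , a⋈v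
    ... | _ | inj₂ a⋈w | _ | _ = a , w , inj₁ refl , inj₂ (inj₂ (inj₂ refl)) , a<w , a⋈w
    ... | _ | _ | inj₂ b⋈v | _ = b , v , inj₂ (inj₁ refl) , inj₂ (inj₂ (inj₁ refl)) , b<v , b⋈v
    ... | _ | _ | _ | inj₂ b⋈w = b , w , inj₂ (inj₁ refl) , inj₂ (inj₂ (inj₂ refl)) , b<w , b⋈w
    ... | inj₁ av | inj₁ aw | inj₁ bv | inj₁ bw =
      ⊥-elim (RetractionObstruction.not-all-joined complete a∥b v∥w La Lb Uv Uw
                (proj₁ (proj₂ R)) (retract-fixes R) (retract-lands R) av aw bv bw)

corollary2 : (n : ℕ) → (_≼_ : Rel (Fin n) 0ℓ) →
    IsPartialOrder _≡_ _≼_ → Decidable _≼_ →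
    2 ≤ n → Poset.NoIsolated _≼_ →
    (a b v w : Fin n) →
    Poset.Crown _≼_ a b v w →
    Poset.E _≼_ a → Poset.E _≼_ b → Poset.E _≼_ v → Poset.E _≼_ w →
    Poset.FComplete _≼_ →
    Poset.IsRetract _≼_ (Poset.In4 _≼_ a b v w)
      ⇔ (∃ λ x → ∃ λ y →
           Poset.In4 _≼_ a b v w x × Poset.In4 _≼_ a b v w y ×
           Poset._<_ _≼_ x y ×
           (∀ m → Poset.BundleRep _≼_ m → ¬ (Poset.Ξ _≼_ m x × Poset.Ξ _≼_ m y)))
corollary2 n _≼_ po _≼?_ _ noIsolated a b v w C@(a<v , a<w , b<v , _) Ea Eb Ev Ew complete =
  mk⇔ (retract⇒separated complete C La Lb Uv Uw) (separated⇒retract C La Lb Uv Uw)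
  where
  open Poset _≼_
  open WithoutIsolatedPoints _≼_ po _≼?_ noIsolated

  La : L a
  La = E-below⇒L _≼_ Ea a<v

  Lb : L b
  Lb = E-below⇒L _≼_ Eb b<v

  Uv : U v
  Uv = E-above⇒U _≼_ Ev a<v

  Uw : U w
  Uw = E-above⇒U _≼_ Ew a<w
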